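{- Let $R$ be a differential interaction net, $R\to R'$ one reduction step, and $\varphi$ a path of $R$ long enough with respect to this step such that $\delta(\varphi)=\{\varphi'\}$. Then $n_R(\varphi')=n_R(\varphi)\,n_\varphi(\varphi')$.
   Context: Interaction nets: a simple net consists of finitely many ports, finitely many cells (each cell a nonempty sequence of pairwise distinct ports, distinct cells sharing no port; the first port is the principal port $p(c)$, the $(i+1)$-th the $i$-th auxiliary port $p_i(c)$), a labelling of cells by symbols, a partition of ports into pairs called wires, and a number of loops. Differential interaction nets (dins, Ehrhard–Regnier) use the symbols $\otimes,⅋$ (2 auxiliary ports), $1,\bot$ (0), weakening and co-weakening (0), dereliction and co-dereliction (1), contraction and co-contraction (2), with the standard Ehrhard–Regnier reduction rules between two cells whose principal ports are joined by a wire. Each dereliction and co-dereliction carries a name from a fixed countable set $\mathcal{N}$, injectively inside each simple net. A din is a binary sum-tree whose leaves are simple nets and whose internal nodes carry names, $R_1+_\alpha R_2$, modulo $(R_1+_\beta R_2)+_\alpha(R_3+_\beta R_4)\equiv(R_1+_\alpha R_3)+_\beta(R_2+_\alpha R_4)$ for $\alpha\ne\beta$; reduction acts in a leaf, and the rule between a dereliction named $\alpha$ and a co-contraction (dually co-dereliction named $\alpha$ and contraction) yields a sum $R_1+_\alpha R_2$ where in $R_i$ the (co-)dereliction, still named $\alpha$, is attached to the $i$-th auxiliary wire of the (co-)contraction and a co-weakening (resp. weakening) to the other. Paths: in a simple net, edges are undirected wire edges (one per wire) and, for each auxiliary port $p_i(c)$, a cell edge $c_i$ from $p_i(c)$ to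 $p(c)$ and its reverse $c_i^r$; a path is a finite alternating sequence of ports and edges, consecutive edges composable and exactly one of any two consecutive edges a wire edge. A path in a sum is $b^r\varphi b$ with $\varphi$ a path in a leaf and $b$ the branch from that leaf to the root, a word in $+_{\alpha,1},+_{\alpha,2}$ (left/right child of a node named $\alpha$), modulo $+_{\alpha,i}+_{\beta,j}\equiv+_{\beta,j}+_{\alpha,i}$ for $\alpha\neq\beta$. $\mathcal{N}(\varphi)$ is the set of names of (co-)derelictions traversed by $\varphi$, $\mathcal{N}(R)$ the set of names occurring in $R$. Path reduction: for a step reducing cells $c,c'$ joined by the wire $w$, a path is long enough if it neither starts nor ends at the principal port of $c$ or $c'$; a crossing is a subpath $c_iw{c'_j}^r$ or $c'_jw c_i^r$. $\delta(\varphi)$ is the set of paths of $R'$ obtained as follows: for rules not producing a sum, $\delta(\varphi)=\{\varphi\}$ if $\varphi$ has no crossing, and otherwise each crossing is replaced by a path of the rule's right-hand net between the corresponding ports (all choices, compatibly with reversal and concatenation); for the (co-)dereliction/(co-)contraction rule producing $R_1+_\alpha R_2$: if $\varphi$ has no crossing, $\delta(\varphi)=\{+_{\alpha,1}^r\varphi+_{\alpha,1},+_{\alpha,2}^r\varphi+_{\alpha,2}\}$; if all edges of $\varphi$ in the (co-)contraction $c'$ are $c'_i$ or ${c'_i}^r$ for a single $i$, $\delta(\varphi)=\{+_{\alpha,i}^r\varphi_i+_{\alpha,i}\}$ with $\varphi_i$ obtained by erasing those edges; otherwise $\delta(\varphi)=\emptyset$. Normalizing factors (in the monoid containing idempotents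 $e_\alpha$, $\alpha\in\mathcal{N}$, which commute with each other): $n_{\varphi'}(\varphi)=\prod_{\alpha\in\mathcal{N}(\varphi')\setminus\mathcal{N}(\varphi)}e_\alpha$ and $n_R(\varphi)=\prod_{\alpha\in\mathcal{N}(R)\setminus\mathcal{N}(\varphi)}e_\alpha$. -}

module Defs where

open import Level using (Level)
open import Data.Nat using (ℕ; zero; suc; _+_; _≤ᵇ_; _≡ᵇ_; _<_)
open import Data.Nat.Properties using (_<?_)
open import Data.Fin using (Fin; zero; suc; toℕ; fromℕ<)
open import Data.Fin.Properties using () renaming (_≟_ to _≟F_)
open import Data.Bool using (Bool; true; false; T; not; _∧_; _∨_; if_then_else_)
open import Data.Unit using (tt)
open import Data.Maybe using (Maybe; just; nothing; maybe; _>>=_)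
import Data.Maybe as Maybe
open import Data.List using (List; []; _∷_; _++_; map; filterᵇ; filter; deduplicate; length; allFin; foldr; reverse; concatMap)
open import Data.List.Membership.Propositional using (_∈_)
open import Data.List.Membership.DecPropositional (Data.Nat.Properties._≟_) using () renaming (_∈?_ to _∈ℕ?_)
open import Data.Product using (Σ; _,_; proj₁; proj₂; _×_)
open import Data.Sum using (_⊎_; inj₁; inj₂)
open import Function using (_∘_; case_of_)
open import Relation.Nullary using (¬_; ¬?; yes; no; Dec)
open import Relation.Nullary.Decidable using (⌊_⌋; T?)
open import Relation.Binary.PropositionalEquality using (_≡_; _≢_; refl; subst; sym)
open import Relation.Binary.Definitions using (DecidableEquality)
open import Algebra.Bundles using (Monoid)

import Data.Nat.Properties

allB : {A : Set} → (A → Bool) → List A → Bool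
allB p []       = true
allB p (x ∷ xs) = p x ∧ allB p xs

Name : Set
Name = ℕ

data Sym : Set where
  tensor par one bot weak coweak der coder contr cocontr : Sym

-- number of auxiliary ports
arity : Sym → ℕ
arity tensor  = 2
arity par     = 2
arity one     = 0
arity bot     = 0
arity weak    = 0
arity coweak  = 0
arity der     = 1
arity coder   = 1
arity contr   = 2
arity cocontr = 2

isNamed : Sym → Bool
isNamed der   = true
isNamed coder = true
isNamed _     = false

record SimpleNet : Set₁ where
  field
    Port : Set
    Cell : Set
    _≟P_ : DecidableEquality Port
    _≟C_ : DecidableEquality Cell
    portList : List Port
    portList-complete : ∀ p → p ∈ portList
    cellList : List Cell
    cellList-complete : ∀ c → c ∈ cellList
    label : Cell → Sym
    -- a cell is the sequence of its ports: index zero is the principal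
    -- port, index (suc i) the (i+1)-th auxiliary port
    port : (c : Cell) → Fin (suc (arity (label c))) → Port
    port-disj : ∀ c d i j → port c i ≡ port d j → c ≡ d
    port-inj  : ∀ c i j → port c i ≡ port c j → i ≡ j
    -- the partition of ports into pairs (wires): p is wired to partner p
    partner : Port → Port
    partner-invol : ∀ p → partner (partner p) ≡ p
    partner-nofix : ∀ p → partner p ≢ p
    loops : ℕ
    -- names of (co-)derelictions (the value on other cells is irrelevant)
    name : Cell → Name
    name-inj : ∀ c d → T (isNamed (label c)) → T (isNamed (label d)) →
               name c ≡ name d → c ≡ d

  prin : Cell → Port
  prin c = port c zero

  aux : (c : Cell) → Fin (arity (label c)) → Port
  aux c i = port c (suc i)

  portℕ : Cell → ℕ → Maybe Port
  portℕ c k with k <? suc (arity (label c))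
  ... | yes h = just (port c (fromℕ< h))
  ... | no _  = nothing

  -- i-th auxiliary port, counting from 0
  auxℕ : Cell → ℕ → Maybe Port
  auxℕ c i = portℕ c (suc i)

open SimpleNet

-- A path is a start port followed by a sequence of edges:
--   W      : the wire edge at the current port (from p to partner p),
--   F c i  : the cell edge c_i from the i-th auxiliary port to the principal port,
--   B c i  : its reverse c_i^r.
-- (auxiliary ports counted from 0).  The intermediate ports are determined.

data Stp (C : Set) : Set where
  W : Stp C
  F : C → ℕ → Stp C
  B : C → ℕ → Stp C

mapStp : {C D : Set} → (C → D) → Stp C → Stp D
mapStp f W       = W
mapStp f (F c i) = F (f c) i
mapStp f (B c i) = B (f c) i

flipStp : {C : Set} → Stp C → Stp C
flipStp W       = W
flipStp (F c i) = B c i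
flipStp (B c i) = F c i

record RawPath (N : SimpleNet) : Set where
  constructor mkPath
  field
    start : Port N
    steps : List (Stp (Cell N))

open RawPath

data Prev : Set where
  none wire cell : Prev

-- composability and alternation (exactly one of two consecutive edges is a wire edge)
data Valid (N : SimpleNet) : Prev → Port N → List (Stp (Cell N)) → Set where
  endᵛ : ∀ {k p} → Valid N k p []
  Wᵛ   : ∀ {k p xs} → k ≢ wire → Valid N wire (partner N p) xs → Valid N k p (W ∷ xs)
  Fᵛ   : ∀ {k p d i xs} → k ≢ cell → auxℕ N d i ≡ just p →
         Valid N cell (prin N d) xs → Valid N k p (F d i ∷ xs)
  Bᵛ   : ∀ {k p q d i xs} → k ≢ cell → prin N d ≡ p → auxℕ N d i ≡ just q →
         Valid N cell q xs → Valid N k p (B d i ∷ xs)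

IsPath : (N : SimpleNet) → RawPath N → Set
IsPath N φ = Valid N none (start φ) (steps φ)

endPortFrom : (N : SimpleNet) → Port N → List (Stp (Cell N)) → Maybe (Port N)
endPortFrom N p []           = just p
endPortFrom N p (W ∷ xs)     = endPortFrom N (partner N p) xs
endPortFrom N p (F d i ∷ xs) = endPortFrom N (prin N d) xs
endPortFrom N p (B d i ∷ xs) = auxℕ N d i >>= λ q → endPortFrom N q xs

endPort : (N : SimpleNet) → RawPath N → Maybe (Port N)
endPort N φ = endPortFrom N (start φ) (steps φ)

stepNames : (N : SimpleNet) → Stp (Cell N) → List Name
stepNames N W       = []
stepNames N (F d _) = if isNamed (label N d) then name N d ∷ [] else []
stepNames N (B d _) = if isNamed (label N d) then name N d ∷ [] else []

pathNames : (N : SimpleNet) → RawPath N → List Name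
pathNames N φ = concatMap (stepNames N) (steps φ)

netNames : SimpleNet → List Name
netNames N = map (name N) (filterᵇ (isNamed ∘ label N) (cellList N))

-- Rules (principal ports of c and c' joined by a wire; the pair of labels
-- in the orientation listed).  The rules der/coweak and weak/coder, whose
-- right-hand side is the empty sum 0, are not included.

data Rule : Sym → Sym → Set where
  r-tensor-par    : Rule tensor par
  r-one-bot       : Rule one bot
  r-der-coder     : Rule der coder
  r-weak-coweak   : Rule weak coweak
  r-weak-cocontr  : Rule weak cocontr
  r-coweak-contr  : Rule coweak contr
  r-contr-cocontr : Rule contr cocontr

data SumRule : Sym → Sym → Set where
  r-der-cocontr : SumRule der cocontr
  r-coder-contr : SumRule coder contr

-- Interface ends: inj₁ i = i-th aux port of c, inj₂ j = j-th aux port of c'.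
-- New cells are Fin NC, their ports NewPort (index 0 = principal).
-- link: wires of the right-hand side, between interface ends and new ports.
-- seg i j: the path of the right-hand side between the ports corresponding
--   to the i-th aux port of c and the j-th aux port of c' (if any; in each
--   rule there is at most one such path).

NewPort : ∀ {n} → (Fin n → Sym) → Set
NewPort {n} lab = Σ (Fin n) (λ k → Fin (suc (arity (lab k))))

record Template (a b : Sym) : Set where
  field
    NC   : ℕ
    lab  : Fin NC → Sym
    link : (Fin (arity a) ⊎ Fin (arity b)) ⊎ NewPort lab →
           (Fin (arity a) ⊎ Fin (arity b)) ⊎ NewPort lab
    seg  : ℕ → ℕ → Maybe (List (Stp (Fin NC)))

open Template

private
  noCell : {A : Set} → Fin 0 → A
  noCell ()

t-tensor-par : Template tensor par
NC   t-tensor-par = 0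
lab  t-tensor-par = noCell
link t-tensor-par (inj₁ (inj₁ i)) = inj₁ (inj₂ i)
link t-tensor-par (inj₁ (inj₂ j)) = inj₁ (inj₁ j)
link t-tensor-par (inj₂ (() , _))
seg  t-tensor-par i j = if i ≡ᵇ j then just [] else nothing

t-one-bot : Template one bot
NC   t-one-bot = 0
lab  t-one-bot = noCell
link t-one-bot (inj₁ (inj₁ ()))
link t-one-bot (inj₁ (inj₂ ()))
link t-one-bot (inj₂ (() , _))
seg  t-one-bot _ _ = nothing

t-der-coder : Template der coder
NC   t-der-coder = 0
lab  t-der-coder = noCell
link t-der-coder (inj₁ (inj₁ zero)) = inj₁ (inj₂ zero)
link t-der-coder (inj₁ (inj₂ zero)) = inj₁ (inj₁ zero)
link t-der-coder (inj₂ (() , _))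
seg  t-der-coder zero zero = just []
seg  t-der-coder _ _ = nothing

t-weak-coweak : Template weak coweak
NC   t-weak-coweak = 0
lab  t-weak-coweak = noCell
link t-weak-coweak (inj₁ (inj₁ ()))
link t-weak-coweak (inj₁ (inj₂ ()))
link t-weak-coweak (inj₂ (() , _))
seg  t-weak-coweak _ _ = nothing

t-weak-cocontr : Template weak cocontr
NC   t-weak-cocontr = 2
lab  t-weak-cocontr _ = weak
link t-weak-cocontr (inj₁ (inj₁ ()))
link t-weak-cocontr (inj₁ (inj₂ j)) = inj₂ (j , zero)
link t-weak-cocontr (inj₂ (k , zero)) = inj₁ (inj₂ k)
seg  t-weak-cocontr _ _ = nothing

t-coweak-contr : Template coweak contr
NC   t-coweak-contr = 2
lab  t-coweak-contr _ = coweak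
link t-coweak-contr (inj₁ (inj₁ ()))
link t-coweak-contr (inj₁ (inj₂ j)) = inj₂ (j , zero)
link t-coweak-contr (inj₂ (k , zero)) = inj₁ (inj₂ k)
seg  t-coweak-contr _ _ = nothing

-- New cells: 0,1 = co-contractions d_0,d_1
-- (principal port on the i-th aux port of c), 2,3 = contractions e_0,e_1
-- (principal port on the j-th aux port of c'); aux j of d_i wired to aux i of e_j.
t-contr-cocontr : Template contr cocontr
NC   t-contr-cocontr = 4
lab  t-contr-cocontr zero                = cocontr
lab  t-contr-cocontr (suc zero)          = cocontr
lab  t-contr-cocontr (suc (suc zero))    = contr
lab  t-contr-cocontr (suc (suc (suc zero))) = contr
link t-contr-cocontr (inj₁ (inj₁ zero))       = inj₂ (zero , zero)
link t-contr-cocontr (inj₁ (inj₁ (suc zero))) = inj₂ (suc zero , zero)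
link t-contr-cocontr (inj₁ (inj₂ zero))       = inj₂ (suc (suc zero) , zero)
link t-contr-cocontr (inj₁ (inj₂ (suc zero))) = inj₂ (suc (suc (suc zero)) , zero)
link t-contr-cocontr (inj₂ (zero , zero))             = inj₁ (inj₁ zero)
link t-contr-cocontr (inj₂ (zero , suc zero))         = inj₂ (suc (suc zero) , suc zero)
link t-contr-cocontr (inj₂ (zero , suc (suc zero)))   = inj₂ (suc (suc (suc zero)) , suc zero)
link t-contr-cocontr (inj₂ (suc zero , zero))           = inj₁ (inj₁ (suc zero))
link t-contr-cocontr (inj₂ (suc zero , suc zero))       = inj₂ (suc (suc zero) , suc (suc zero))
link t-contr-cocontr (inj₂ (suc zero , suc (suc zero))) = inj₂ (suc (suc (suc zero)) , suc (suc zero))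
link t-contr-cocontr (inj₂ (suc (suc zero) , zero))           = inj₁ (inj₂ zero)
link t-contr-cocontr (inj₂ (suc (suc zero) , suc zero))       = inj₂ (zero , suc zero)
link t-contr-cocontr (inj₂ (suc (suc zero) , suc (suc zero))) = inj₂ (suc zero , suc zero)
link t-contr-cocontr (inj₂ (suc (suc (suc zero)) , zero))           = inj₁ (inj₂ (suc zero))
link t-contr-cocontr (inj₂ (suc (suc (suc zero)) , suc zero))       = inj₂ (zero , suc (suc zero))
link t-contr-cocontr (inj₂ (suc (suc (suc zero)) , suc (suc zero))) = inj₂ (suc zero , suc (suc zero))
-- from the i-th aux port of c (principal of d_i) to the j-th aux port of c'
-- (principal of e_j): d_{i,j}^r, wire, e_{j,i}
seg  t-contr-cocontr 0 0 = just (B zero 0 ∷ W ∷ F (suc (suc zero)) 0 ∷ [])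
seg  t-contr-cocontr 0 1 = just (B zero 1 ∷ W ∷ F (suc (suc (suc zero))) 0 ∷ [])
seg  t-contr-cocontr 1 0 = just (B (suc zero) 0 ∷ W ∷ F (suc (suc zero)) 1 ∷ [])
seg  t-contr-cocontr 1 1 = just (B (suc zero) 1 ∷ W ∷ F (suc (suc (suc zero))) 1 ∷ [])
seg  t-contr-cocontr _ _ = nothing

tmpl : ∀ {a b} → Rule a b → Template a b
tmpl r-tensor-par    = t-tensor-par
tmpl r-one-bot       = t-one-bot
tmpl r-der-coder     = t-der-coder
tmpl r-weak-coweak   = t-weak-coweak
tmpl r-weak-cocontr  = t-weak-cocontr
tmpl r-coweak-contr  = t-coweak-contr
tmpl r-contr-cocontr = t-contr-cocontr

other : Fin 2 → Fin 2
other zero       = suc zero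
other (suc zero) = zero

-- (co-)dereliction / (co-)contraction, i-th summand (br : Fin 2, 0 = first):
-- new cell 0 = the (co-)dereliction (principal port on the br-th aux port of
-- c', aux port where c's aux port was), new cell 1 = the (co-)weakening on
-- the other aux port of c'.
t-sum : (a w : Sym) → arity a ≡ 1 → ∀ {b} → arity b ≡ 2 → Fin 2 → Template a b
t-sum a w ha hb br = record { NC = 2 ; lab = lb ; link = lk ; seg = sg }
  where
  lb : Fin 2 → Sym
  lb zero       = a
  lb (suc zero) = w
  lk : _
  lk (inj₁ (inj₁ i)) = inj₂ (zero , suc (subst Fin (sym ha) zero))
  lk (inj₁ (inj₂ j)) with toℕ j ≡ᵇ toℕ br
  ... | true  = inj₂ (zero , zero)
  ... | false = inj₂ (suc zero , zero)
  lk (inj₂ (zero , zero))         = inj₁ (inj₂ (subst Fin (sym hb) br))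
  lk (inj₂ (zero , suc _))        = inj₁ (inj₁ (subst Fin (sym ha) zero))
  lk (inj₂ (suc zero , _))        = inj₁ (inj₂ (subst Fin (sym hb) (other br)))
  sg : ℕ → ℕ → Maybe (List (Stp (Fin 2)))
  sg 0 j = if j ≡ᵇ toℕ br then just (F zero 0 ∷ []) else nothing
  sg _ _ = nothing

tmplS : ∀ {a b} → SumRule a b → Fin 2 → Template a b
tmplS r-der-cocontr = t-sum der coweak refl refl
tmplS r-coder-contr = t-sum coder weak refl refl

module Redex (N : SimpleNet) (c c' : Cell N) where

  private
    _≟P'_ = _≟P_ N
    _≟C'_ = _≟C_ N

  Iface : Set
  Iface = Fin (arity (label N c)) ⊎ Fin (arity (label N c'))

  ifacePort : Iface → Port N
  ifacePort (inj₁ i) = aux N c i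
  ifacePort (inj₂ j) = aux N c' j

  ifaceIdx : Iface → ℕ
  ifaceIdx (inj₁ i) = toℕ i
  ifaceIdx (inj₂ j) = arity (label N c) + toℕ j

  ifaceList : List Iface
  ifaceList = map inj₁ (allFin _) ++ map inj₂ (allFin _)

  findFin : ∀ {n} → (Fin n → Bool) → Maybe (Fin n)
  findFin {zero}  f = nothing
  findFin {suc n} f = if f zero then just zero else Maybe.map suc (findFin (f ∘ suc))

  data PKind : Set where
    princ : PKind
    ifc   : Iface → PKind
    out   : PKind

  kind : Port N → PKind
  kind p with ⌊ p ≟P' prin N c ⌋ ∨ ⌊ p ≟P' prin N c' ⌋
  ... | true  = princ
  ... | false with findFin (λ i → ⌊ aux N c i ≟P' p ⌋)
  ...   | just i  = ifc (inj₁ i)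
  ...   | nothing with findFin (λ j → ⌊ aux N c' j ≟P' p ⌋)
  ...     | just j  = ifc (inj₂ j)
  ...     | nothing = out

  isOut : Port N → Bool
  isOut p with kind p
  ... | out = true
  ... | _   = false

  OutPort : Set
  OutPort = Σ (Port N) (λ p → T (isOut p))

  toOut : Port N → Maybe OutPort
  toOut p with T? (isOut p)
  ... | yes h = just (p , h)
  ... | no _  = nothing

  isOutC : Cell N → Bool
  isOutC d = not (⌊ d ≟C' c ⌋ ∨ ⌊ d ≟C' c' ⌋)

  OutCell : Set
  OutCell = Σ (Cell N) (λ d → T (isOutC d))

  data CKind : Set where
    isC isC' : CKind
    outC     : OutCell → CKind

  cellKind : Cell N → CKind
  cellKind d with T? (isOutC d)
  ... | yes h = outC (d , h)
  ... | no _  = if ⌊ d ≟C' c ⌋ then isC else isC'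

  module WithTemplate (t : Template (label N c) (label N c')) where

    NP : Set
    NP = NewPort (lab t)

    End : Set
    End = Iface ⊎ NP

    newPortℕ : Fin (NC t) → ℕ → Maybe NP
    newPortℕ k m with m <? suc (arity (lab t k))
    ... | yes h = just (k , fromℕ< h)
    ... | no _  = nothing

    -- wires of the reduct: follow wires of N and of the right-hand side
    -- through the interface until reaching an outside port or a new port
    -- (fuel 5 suffices: there are at most 4 interface ends)
    mutual
      goLink : ℕ → Iface → Maybe (OutPort ⊎ NP)
      goLink n a with link t (inj₁ a)
      ... | inj₂ r = just (inj₂ r)
      ... | inj₁ b = goPartner n b

      goPartner : ℕ → Iface → Maybe (OutPort ⊎ NP)
      goPartner zero    b = nothing
      goPartner (suc n) b with kind (partner N (ifacePort b))
      ... | ifc a = goLink n a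
      ... | princ = nothing
      ... | out   = Maybe.map inj₁ (toOut (partner N (ifacePort b)))

    resolve : OutPort ⊎ NP → Maybe (OutPort ⊎ NP)
    resolve (inj₁ (p , _)) with kind (partner N p)
    ... | ifc a = goLink 5 a
    ... | princ = nothing
    ... | out   = Maybe.map inj₁ (toOut (partner N p))
    resolve (inj₂ r) with link t (inj₂ r)
    ... | inj₂ r' = just (inj₂ r')
    ... | inj₁ b  = goPartner 5 b

    -- loops created by the step: cycles formed only of wires of N between
    -- interface ports and wires of the right-hand side between interface ends
    linkI : Iface → Maybe Iface
    linkI a with link t (inj₁ a)
    ... | inj₁ b = just b
    ... | inj₂ _ = nothing

    succI : Iface → Maybe Iface
    succI a = linkI a >>= λ b → nxt (kind (partner N (ifacePort b)))
      where
      nxt : PKind → Maybe Iface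
      nxt (ifc a') = just a'
      nxt _        = nothing

    orbit : ℕ → Iface → Iface → Maybe (List Iface)
    orbit zero    a₀ x = nothing
    orbit (suc n) a₀ x = succI x >>= λ y →
      if ifaceIdx y ≡ᵇ ifaceIdx a₀ then just (x ∷ []) else Maybe.map (x ∷_) (orbit n a₀ y)

    -- a is the representative (least index) of a closed cycle
    isRep : Iface → Bool
    isRep a with orbit 4 a a
    ... | nothing = false
    ... | just xs = allB (λ x → (ifaceIdx a ≤ᵇ ifaceIdx x) ∧
                              maybe (λ y → ifaceIdx a ≤ᵇ ifaceIdx y) false (linkI x)) xs

    newLoops : ℕ
    newLoops = length (filterᵇ isRep ifaceList)

    forget : OutPort ⊎ NP → Port N ⊎ NP
    forget (inj₁ (p , _)) = inj₁ p
    forget (inj₂ r)       = inj₂ r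

    -- N' is (up to the given identifications) the net obtained from N by
    -- erasing c, c' and the wire between their principal ports and plugging
    -- the right-hand side t.
    record Realizes (N' : SimpleNet) : Set where
      field
        toP   : Port N' → OutPort ⊎ NP
        fromP : OutPort ⊎ NP → Port N'
        toP-fromP : ∀ x → toP (fromP x) ≡ x
        fromP-toP : ∀ x → fromP (toP x) ≡ x
        toC   : Cell N' → OutCell ⊎ Fin (NC t)
        fromC : OutCell ⊎ Fin (NC t) → Cell N'
        toC-fromC : ∀ x → toC (fromC x) ≡ x
        fromC-toC : ∀ x → fromC (toC x) ≡ x
        label-old : ∀ d → label N' (fromC (inj₁ d)) ≡ label N (proj₁ d)
        label-new : ∀ k → label N' (fromC (inj₂ k)) ≡ lab t k
        port-old  : ∀ d m → Maybe.map (forget ∘ toP) (portℕ N' (fromC (inj₁ d)) m)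
                            ≡ Maybe.map inj₁ (portℕ N (proj₁ d) m)
        port-new  : ∀ k m → Maybe.map toP (portℕ N' (fromC (inj₂ k)) m) ≡ Maybe.map inj₂ (newPortℕ k m)
        wires     : ∀ x → just (toP (partner N' x)) ≡ resolve (toP x)
        loops-eq  : loops N' ≡ loops N + newLoops
        name-old  : ∀ d → T (isNamed (label N (proj₁ d))) →
                    name N' (fromC (inj₁ d)) ≡ name N (proj₁ d)
        name-new  : ∀ k → T (isNamed (lab t k)) → name N' (fromC (inj₂ k)) ≡ name N c

    module Translate {N' : SimpleNet} (ρ : Realizes N') where
      open Realizes ρ

      corr : Port N → Maybe (Port N')
      corr p with kind p
      ... | princ = nothing
      ... | out   = Maybe.map (fromP ∘ inj₁) (toOut p)
      ... | ifc a with link t (inj₁ a)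
      ...   | inj₂ r = just (fromP (inj₂ r))
      ...   | inj₁ _ = nothing

      newStp : Stp (Fin (NC t)) → Stp (Cell N')
      newStp = mapStp (fromC ∘ inj₂)

      segN : ℕ → ℕ → Maybe (List (Stp (Cell N')))
      segN i j = Maybe.map (map newStp) (seg t i j)

      revSeg : List (Stp (Cell N')) → List (Stp (Cell N'))
      revSeg xs = reverse (map flipStp xs)

      tr1 : Stp (Cell N) → Maybe (Stp (Cell N'))
      tr1 W = just W
      tr1 (F d i) with cellKind d
      ... | outC o = just (F (fromC (inj₁ o)) i)
      ... | _      = nothing
      tr1 (B d i) with cellKind d
      ... | outC o = just (B (fromC (inj₁ o)) i)
      ... | _      = nothing

      _∷?_ : Maybe (Stp (Cell N')) → Maybe (List (Stp (Cell N'))) → Maybe (List (Stp (Cell N')))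
      mx ∷? mxs = mx >>= λ x → Maybe.map (x ∷_) mxs

      _++?_ : Maybe (List (Stp (Cell N'))) → Maybe (List (Stp (Cell N'))) → Maybe (List (Stp (Cell N')))
      mx ++? mxs = mx >>= λ x → Maybe.map (x ++_) mxs

      crossing : CKind → CKind → ℕ → ℕ → Maybe (List (Stp (Cell N'))) →
                 Maybe (List (Stp (Cell N'))) → Maybe (List (Stp (Cell N')))
      crossing isC  isC' i j rest _ = segN i j ++? rest
      crossing isC' isC  i j rest _ = Maybe.map revSeg (segN j i) ++? rest
      crossing _    _    i j _ noCross = noCross

      -- each crossing c_i w c'_j^r (resp. c'_j w c_i^r) is replaced by the
      -- right-hand-side path between the corresponding ports (resp. its reverse)
      tr : List (Stp (Cell N)) → Maybe (List (Stp (Cell N')))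
      tr [] = just []
      tr (W ∷ xs) = just W ∷? tr xs
      tr (F d i ∷ W ∷ B d' j ∷ ys) =
        crossing (cellKind d) (cellKind d') i j (tr ys) (tr1 (F d i) ∷? tr (W ∷ B d' j ∷ ys))
      tr (x ∷ xs) = tr1 x ∷? tr xs

      -- consecutive wire edges of N are merged into one wire edge of N'
      collapse : List (Stp (Cell N')) → List (Stp (Cell N'))
      collapse [] = []
      collapse (W ∷ xs@(W ∷ _)) = collapse xs
      collapse (x ∷ xs) = x ∷ collapse xs

      translate : RawPath N → Maybe (RawPath N')
      translate φ =
        corr (start φ) >>= λ s →
        endPort N φ >>= λ e →
        corr e >>= λ _ →
        tr (steps φ) >>= λ xs →
        just (mkPath s (collapse xs))

record Step (N N' : SimpleNet) : Set where
  field
    c c'  : Cell N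
    wired : partner N (prin N c) ≡ prin N c'
    rule  : Rule (label N c) (label N c')
    real  : Redex.WithTemplate.Realizes N c c' (tmpl rule) N'

record StepSum (N : SimpleNet) (α : Name) (N₁ N₂ : SimpleNet) : Set where
  field
    c c'  : Cell N
    wired : partner N (prin N c) ≡ prin N c'
    rule  : SumRule (label N c) (label N c')
    named : name N c ≡ α
    real₁ : Redex.WithTemplate.Realizes N c c' (tmplS rule zero) N₁
    real₂ : Redex.WithTemplate.Realizes N c c' (tmplS rule (suc zero)) N₂

LongEnoughAt : (N : SimpleNet) (c c' : Cell N) → RawPath N → Set
LongEnoughAt N c c' φ =
  start φ ≢ prin N c × start φ ≢ prin N c' ×
  endPort N φ ≢ just (prin N c) × endPort N φ ≢ just (prin N c')

δStep : ∀ {N N'} → Step N N' → RawPath N → RawPath N' → Set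
δStep {N} s φ ψ = Translate.translate real φ ≡ just ψ
  where open Step s
        open Redex N c c'
        open WithTemplate (tmpl rule)

-- δ for a sum step: ψ is a path of the summand number br
-- (translation with respect to the br-th right-hand side; this yields both
-- summands when φ has no crossing, only the i-th summand when all edges of
-- φ in c' are c'_i or c'_i^r, and nothing otherwise)
δStepSum : ∀ {N α N₁ N₂} → StepSum N α N₁ N₂ → RawPath N →
           (br : Fin 2) → RawPath (if ⌊ br ≟F zero ⌋ then N₁ else N₂) → Set
δStepSum {N} s φ zero ψ = Translate.translate real₁ φ ≡ just ψ
  where open StepSum s
        open Redex N c c'
        open WithTemplate (tmplS rule zero)
δStepSum {N} s φ (suc zero) ψ = Translate.translate real₂ φ ≡ just ψ
  where open StepSum s
        open Redex N c c'
        open WithTemplate (tmplS rule (suc zero))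

-- Differential interaction nets: binary sum-trees of simple nets with named
-- internal nodes (concrete representatives)

data Din : Set₁ where
  leaf  : SimpleNet → Din
  sumₙ  : Din → Name → Din → Din

dinNames : Din → List Name
dinNames (leaf N)       = netNames N
dinNames (sumₙ R₁ α R₂) = α ∷ dinNames R₁ ++ dinNames R₂

-- a path of a din: b^r φ b with b the branch from a leaf to the root
data DPath : Din → Set₁ where
  here : ∀ {N} → RawPath N → DPath (leaf N)
  left  : ∀ {R₁ α R₂} → DPath R₁ → DPath (sumₙ R₁ α R₂)
  right : ∀ {R₁ α R₂} → DPath R₂ → DPath (sumₙ R₁ α R₂)

IsDPath : ∀ {R} → DPath R → Set
IsDPath (here {N} φ) = IsPath N φ
IsDPath (left φ)     = IsDPath φ
IsDPath (right φ)    = IsDPath φ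

dpathNames : ∀ {R} → DPath R → List Name
dpathNames (here {N} φ) = pathNames N φ
dpathNames (left φ)     = dpathNames φ
dpathNames (right φ)    = dpathNames φ

data DStep : Din → Din → Set₁ where
  leafStep : ∀ {N N'} → Step N N' → DStep (leaf N) (leaf N')
  leafSum  : ∀ {N α N₁ N₂} → StepSum N α N₁ N₂ →
             DStep (leaf N) (sumₙ (leaf N₁) α (leaf N₂))
  inLeft   : ∀ {R₁ R₁' α R₂} → DStep R₁ R₁' → DStep (sumₙ R₁ α R₂) (sumₙ R₁' α R₂)
  inRight  : ∀ {R₁ α R₂ R₂'} → DStep R₂ R₂' → DStep (sumₙ R₁ α R₂) (sumₙ R₁ α R₂')

-- long enough with respect to the step (paths in other leaves are not
-- affected by the step)
LongEnough : ∀ {R R'} → DStep R R' → DPath R → Set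
LongEnough (leafStep s) (here φ) = LongEnoughAt _ (Step.c s) (Step.c' s) φ
LongEnough (leafSum s)  (here φ) = LongEnoughAt _ (StepSum.c s) (StepSum.c' s) φ
LongEnough (inLeft s)  (left φ)  = LongEnough s φ
LongEnough (inLeft s)  (right φ) = Data.Unit.⊤
LongEnough (inRight s) (left φ)  = Data.Unit.⊤
LongEnough (inRight s) (right φ) = LongEnough s φ

data δ : ∀ {R R'} → DStep R R' → DPath R → DPath R' → Set₁ where
  δ-leaf  : ∀ {N N'} {s : Step N N'} {φ ψ} → δStep s φ ψ → δ (leafStep s) (here φ) (here ψ)
  δ-sum₁  : ∀ {N α N₁ N₂} {s : StepSum N α N₁ N₂} {φ ψ} →
            δStepSum s φ zero ψ → δ (leafSum s) (here φ) (left (here ψ))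
  δ-sum₂  : ∀ {N α N₁ N₂} {s : StepSum N α N₁ N₂} {φ ψ} →
            δStepSum s φ (suc zero) ψ → δ (leafSum s) (here φ) (right (here ψ))
  δ-inL   : ∀ {R₁ R₁' α R₂} {s : DStep R₁ R₁'} {φ ψ} →
            δ s φ ψ → δ (inLeft {α = α} {R₂ = R₂} s) (left φ) (left ψ)
  δ-inL'  : ∀ {R₁ R₁' α R₂} {s : DStep R₁ R₁'} {φ} →
            δ (inLeft {α = α} {R₂ = R₂} s) (right φ) (right φ)
  δ-inR   : ∀ {R₁ α R₂ R₂'} {s : DStep R₂ R₂'} {φ ψ} →
            δ s φ ψ → δ (inRight {R₁ = R₁} {α = α} s) (right φ) (right ψ)
  δ-inR'  : ∀ {R₁ α R₂ R₂'} {s : DStep R₂ R₂'} {φ} →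
            δ (inRight {R₁ = R₁} {α = α} s) (left φ) (left φ)

module Factors {a ℓ : Level} (M : Monoid a ℓ) (e : Name → Monoid.Carrier M) where
  open Monoid M

  ∏e : List Name → Carrier
  ∏e = foldr (λ α m → e α ∙ m) ε

  ∏diff : List Name → List Name → Carrier
  ∏diff X Y = ∏e (deduplicate Data.Nat.Properties._≟_ (filter (λ α → ¬? (α ∈ℕ? Y)) X))

  n-path : ∀ {R R'} → DPath R' → DPath R → Carrier
  n-path φ' φ = ∏diff (dpathNames φ') (dpathNames φ)

  n-din : ∀ {R'} → Din → DPath R' → Carrier
  n-din R φ = ∏diff (dinNames R) (dpathNames φ)

module Submission where

open import Defs
open import Level using (Level)
open import Algebra.Bundles using (Monoid)
open import Relation.Binary.PropositionalEquality using (_≡_)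

open import Relation.Binary.PropositionalEquality using (refl; sym; trans; subst)
import Data.Nat.Properties as ℕ
open import Data.Bool using (true; false; T; if_then_else_)
open import Data.Unit using (tt)
open import Data.Maybe using (just; nothing)
import Data.Maybe as Maybe
open import Data.Maybe.Relation.Unary.All using (All; just; nothing; universal)
import Data.Maybe.Relation.Unary.All as All
import Data.Maybe.Relation.Unary.All.Properties as All
open import Data.Fin using (zero; suc)
open import Data.List using (List; []; _∷_; _++_; map; filter; deduplicate; concatMap; reverse)
open import Data.List.Properties using (concatMap-++; concatMap-map; concatMap-cong)
open import Data.List.Relation.Unary.Any using (here; there; satisfied)
import Data.List.Relation.Unary.Any.Properties as Any
open import Data.List.Membership.Propositional using (_∈_; _∉_)
open import Data.List.Membership.Propositional.Properties
  using (∈-++⁺ˡ; ∈-++⁺ʳ; ∈-++⁻; ∈-filter⁺; ∈-filter⁻; ∈-deduplicate⁺; ∈-deduplicate⁻; ∈-map⁺; ∈-concatMap⁻)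
open import Data.List.Membership.DecPropositional ℕ._≟_ using (_∈?_)
open import Data.List.Relation.Binary.Subset.Propositional using (_⊆_)
open import Data.List.Relation.Binary.Subset.Propositional.Properties
  using (⊆-trans; ⊆-reflexive; ++⁺; ++⁺ʳ; xs⊆ys++xs; concatMap⁺; ∷⁺ʳ)
open import Data.Product using (_,_; proj₁; _×_)
open import Data.Sum using (inj₁; inj₂)
open import Relation.Nullary using (¬?; yes; no)
open import Relation.Nullary.Decidable using (T?)
open import Function using (_∘_)
open SimpleNet
open Template

-- The transformation δ never creates names: an edge outside the redex keeps the
-- name of its cell, and the only named cells of a right-hand side are copies of
-- the (co-)dereliction c, which every crossing traverses.  Hence
-- 𝒩(φ') ⊆ 𝒩(φ) ⊆ 𝒩(R), so 𝒩(R) ∖ 𝒩(φ') is the disjoint union of 𝒩(R) ∖ 𝒩(φ)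
-- and 𝒩(φ) ∖ 𝒩(φ'); and a product of commuting idempotents depends only on the
-- set of its factors.

module CommutingIdempotents {a ℓ : Level} (M : Monoid a ℓ) (e : Name → Monoid.Carrier M)
  (e-idem : ∀ α → Monoid._≈_ M (Monoid._∙_ M (e α) (e α)) (e α))
  (e-comm : ∀ α β → Monoid._≈_ M (Monoid._∙_ M (e α) (e β)) (Monoid._∙_ M (e β) (e α))) where

  open Monoid M hiding (refl; sym; trans)
  open Factors M e using (∏e; ∏diff)
  open import Relation.Binary.Reasoning.Setoid setoid

  e-swap : ∀ α β x → e α ∙ (e β ∙ x) ≈ e β ∙ (e α ∙ x)
  e-swap α β x = begin
    e α ∙ (e β ∙ x) ≈⟨ assoc _ _ _ ⟨
    (e α ∙ e β) ∙ x ≈⟨ ∙-congʳ (e-comm α β) ⟩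
    (e β ∙ e α) ∙ x ≈⟨ assoc _ _ _ ⟩
    e β ∙ (e α ∙ x) ∎

  e∙∏e-comm : ∀ α L → e α ∙ ∏e L ≈ ∏e L ∙ e α
  e∙∏e-comm α []      = Monoid.trans M (identityʳ _) (Monoid.sym M (identityˡ _))
  e∙∏e-comm α (β ∷ L) = begin
    e α ∙ (e β ∙ ∏e L) ≈⟨ e-swap α β (∏e L) ⟩
    e β ∙ (e α ∙ ∏e L) ≈⟨ ∙-congˡ (e∙∏e-comm α L) ⟩
    e β ∙ (∏e L ∙ e α) ≈⟨ assoc _ _ _ ⟨
    (e β ∙ ∏e L) ∙ e α ∎

  ∏e-comm : ∀ L L' → ∏e L ∙ ∏e L' ≈ ∏e L' ∙ ∏e L
  ∏e-comm []      L' = Monoid.trans M (identityˡ _) (Monoid.sym M (identityʳ _))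
  ∏e-comm (α ∷ L) L' = begin
    (e α ∙ ∏e L) ∙ ∏e L' ≈⟨ assoc _ _ _ ⟩
    e α ∙ (∏e L ∙ ∏e L') ≈⟨ ∙-congˡ (∏e-comm L L') ⟩
    e α ∙ (∏e L' ∙ ∏e L) ≈⟨ assoc _ _ _ ⟨
    (e α ∙ ∏e L') ∙ ∏e L ≈⟨ ∙-congʳ (e∙∏e-comm α L') ⟩
    (∏e L' ∙ e α) ∙ ∏e L ≈⟨ assoc _ _ _ ⟩
    ∏e L' ∙ (e α ∙ ∏e L) ∎

  e∙∏e-absorb : ∀ {α} L → α ∈ L → e α ∙ ∏e L ≈ ∏e L
  e∙∏e-absorb {α} (_ ∷ L) (here refl) = begin
    e α ∙ (e α ∙ ∏e L) ≈⟨ assoc _ _ _ ⟨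
    (e α ∙ e α) ∙ ∏e L ≈⟨ ∙-congʳ (e-idem α) ⟩
    e α ∙ ∏e L         ∎
  e∙∏e-absorb {α} (β ∷ L) (there α∈L) = begin
    e α ∙ (e β ∙ ∏e L) ≈⟨ e-swap α β (∏e L) ⟩
    e β ∙ (e α ∙ ∏e L) ≈⟨ ∙-congˡ (e∙∏e-absorb L α∈L) ⟩
    e β ∙ ∏e L         ∎

  ∏e∙∏e-absorb : ∀ L L' → L ⊆ L' → ∏e L ∙ ∏e L' ≈ ∏e L'
  ∏e∙∏e-absorb []      L' L⊆L' = identityˡ _
  ∏e∙∏e-absorb (α ∷ L) L' L⊆L' = begin
    (e α ∙ ∏e L) ∙ ∏e L' ≈⟨ assoc _ _ _ ⟩
    e α ∙ (∏e L ∙ ∏e L') ≈⟨ ∙-congˡ (∏e∙∏e-absorb L L' (L⊆L' ∘ there)) ⟩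
    e α ∙ ∏e L'          ≈⟨ e∙∏e-absorb L' (L⊆L' (here refl)) ⟩
    ∏e L'                ∎

  ∏e-cong-⊆⊇ : ∀ L L' → L ⊆ L' → L' ⊆ L → ∏e L ≈ ∏e L'
  ∏e-cong-⊆⊇ L L' L⊆L' L'⊆L = begin
    ∏e L          ≈⟨ ∏e∙∏e-absorb L' L L'⊆L ⟨
    ∏e L' ∙ ∏e L  ≈⟨ ∏e-comm L' L ⟩
    ∏e L ∙ ∏e L'  ≈⟨ ∏e∙∏e-absorb L L' L⊆L' ⟩
    ∏e L'         ∎

  ∏e-++ : ∀ L L' → ∏e (L ++ L') ≈ ∏e L ∙ ∏e L'
  ∏e-++ []      L' = Monoid.sym M (identityˡ _)
  ∏e-++ (α ∷ L) L' = Monoid.trans M (∙-congˡ (∏e-++ L L')) (Monoid.sym M (assoc _ _ _))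

  -- ∏diff X Y is definitionally ∏e (X ∖ Y).
  _∖_ : List Name → List Name → List Name
  X ∖ Y = deduplicate ℕ._≟_ (filter (λ α → ¬? (α ∈? Y)) X)

  ∈-∖⁻ : ∀ X Y {α} → α ∈ X ∖ Y → α ∈ X × α ∉ Y
  ∈-∖⁻ X Y = ∈-filter⁻ (λ α → ¬? (α ∈? Y)) ∘ ∈-deduplicate⁻ ℕ._≟_ _

  ∈-∖⁺ : ∀ X Y {α} → α ∈ X → α ∉ Y → α ∈ X ∖ Y
  ∈-∖⁺ X Y α∈X α∉Y = ∈-deduplicate⁺ ℕ._≟_ (∈-filter⁺ (λ α → ¬? (α ∈? Y)) α∈X α∉Y)

  ∏diff-split : ∀ X P Q → P ⊆ X → Q ⊆ P → ∏diff X Q ≈ ∏diff X P ∙ ∏diff P Q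
  ∏diff-split X P Q P⊆X Q⊆P =
    Monoid.trans M (∏e-cong-⊆⊇ (X ∖ Q) (X ∖ P ++ P ∖ Q) split merge) (∏e-++ (X ∖ P) (P ∖ Q))
    where
    split : X ∖ Q ⊆ X ∖ P ++ P ∖ Q
    split {α} α∈X∖Q with ∈-∖⁻ X Q α∈X∖Q | α ∈? P
    ... | α∈X , α∉Q | yes α∈P = ∈-++⁺ʳ (X ∖ P) (∈-∖⁺ P Q α∈P α∉Q)
    ... | α∈X , α∉Q | no α∉P  = ∈-++⁺ˡ (∈-∖⁺ X P α∈X α∉P)
    merge : X ∖ P ++ P ∖ Q ⊆ X ∖ Q
    merge α∈ with ∈-++⁻ (X ∖ P) α∈
    ... | inj₁ α∈X∖P = let α∈X , α∉P = ∈-∖⁻ X P α∈X∖P in ∈-∖⁺ X Q α∈X (α∉P ∘ Q⊆P)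
    ... | inj₂ α∈P∖Q = let α∈P , α∉Q = ∈-∖⁻ P Q α∈P∖Q in ∈-∖⁺ X Q (P⊆X α∈P) α∉Q

concatMap-⊆ : ∀ {A B : Set} (f : A → List B) {Z : List B} xs → (∀ x → f x ⊆ Z) → concatMap f xs ⊆ Z
concatMap-⊆ f xs f⊆Z α∈ = let x , α∈fx = satisfied (∈-concatMap⁻ f {xs} α∈) in f⊆Z x α∈fx

stepsNames : (N : SimpleNet) → List (Stp (Cell N)) → List Name
stepsNames N = concatMap (stepNames N)

stepsNames-++ : ∀ N xs ys → stepsNames N (xs ++ ys) ≡ stepsNames N xs ++ stepsNames N ys
stepsNames-++ N = concatMap-++ (stepNames N)

cellNames : (N : SimpleNet) → Cell N → List Name
cellNames N d = if isNamed (label N d) then name N d ∷ [] else []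

cellNames⊆ : ∀ N (d : Cell N) N' (d' : Cell N') →
             (T (isNamed (label N' d')) → T (isNamed (label N d)) × name N' d' ≡ name N d) →
             cellNames N' d' ⊆ cellNames N d
cellNames⊆ N d N' d' transfer with isNamed (label N' d')
... | false = λ ()
... | true with isNamed (label N d) | transfer tt
...   | true  | _ , same-name = λ { (here refl) → here same-name }
...   | false | () , _

cellNames⊆netNames : ∀ N d → cellNames N d ⊆ netNames N
cellNames⊆netNames N d with isNamed (label N d) in named
... | true = λ { (here refl) →
  ∈-map⁺ (name N) (∈-filter⁺ (λ x → T? (isNamed (label N x))) (cellList-complete N d) (subst T (sym named) tt)) }

stepNames⊆netNames : ∀ N x → stepNames N x ⊆ netNames N
stepNames⊆netNames N W       = λ ()
stepNames⊆netNames N (F d _) = cellNames⊆netNames N d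
stepNames⊆netNames N (B d _) = cellNames⊆netNames N d

dpathNames⊆dinNames : ∀ {R} (φ : DPath R) → dpathNames φ ⊆ dinNames R
dpathNames⊆dinNames (here {N} φ)   = concatMap-⊆ (stepNames N) (RawPath.steps φ) (stepNames⊆netNames N)
dpathNames⊆dinNames (left φ)       = there ∘ ∈-++⁺ˡ ∘ dpathNames⊆dinNames φ
dpathNames⊆dinNames (right {R₁} φ) = there ∘ ∈-++⁺ʳ (dinNames R₁) ∘ dpathNames⊆dinNames φ

revSeg-names : ∀ N xs → stepsNames N (reverse (map flipStp xs)) ⊆ stepsNames N xs
revSeg-names N xs =
  ⊆-trans (concatMap⁺ (stepNames N) (Any.reverse⁻ {xs = map flipStp xs}))
          (⊆-reflexive (trans (concatMap-map (stepNames N) flipStp xs) (concatMap-cong flip-names xs)))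
  where
  flip-names : ∀ x → stepNames N (flipStp x) ≡ stepNames N x
  flip-names W       = refl
  flip-names (F _ _) = refl
  flip-names (B _ _) = refl

NamedCellsInherit : ∀ {a b} → Template a b → Set
NamedCellsInherit {a} t = ∀ k → T (isNamed (lab t k)) → T (isNamed a)

tmpl-inherit : ∀ {a b} (r : Rule a b) → NamedCellsInherit (tmpl r)
tmpl-inherit r-tensor-par    ()
tmpl-inherit r-one-bot       ()
tmpl-inherit r-der-coder     ()
tmpl-inherit r-weak-coweak   ()
tmpl-inherit r-weak-cocontr  _ ()
tmpl-inherit r-coweak-contr  _ ()
tmpl-inherit r-contr-cocontr zero                   ()
tmpl-inherit r-contr-cocontr (suc zero)             ()
tmpl-inherit r-contr-cocontr (suc (suc zero))       ()
tmpl-inherit r-contr-cocontr (suc (suc (suc zero))) ()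

tmplS-inherit : ∀ {a b} (r : SumRule a b) br → NamedCellsInherit (tmplS r br)
tmplS-inherit r-der-cocontr _ _ _ = tt
tmplS-inherit r-coder-contr _ _ _ = tt

module TranslationNames (N : SimpleNet) (c c' : Cell N) where
  open Redex N c c'

  cellKind-outC : ∀ d o → cellKind d ≡ outC o → proj₁ o ≡ d
  cellKind-outC d o eq with T? (isOutC d)
  cellKind-outC d o refl | yes _ = refl
  ... | no _ with (_≟C_ N) d c
  cellKind-outC d o () | no _ | yes _
  cellKind-outC d o () | no _ | no _

  cellKind-isC : ∀ d → cellKind d ≡ isC → d ≡ c
  cellKind-isC d eq with T? (isOutC d)
  cellKind-isC d () | yes _
  ... | no _ with (_≟C_ N) d c
  ... | yes d≡c = d≡c
  cellKind-isC d () | no _ | no _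

  module _ (t : Template (label N c) (label N c')) (inherit : NamedCellsInherit t)
           {N' : SimpleNet} (ρ : WithTemplate.Realizes t N') where
    open WithTemplate t
    open Realizes ρ
    open Translate ρ

    ∷?-names : ∀ {A B} {mx mxs} →
               All (λ y → stepNames N' y ⊆ A) mx → All (λ zs → stepsNames N' zs ⊆ B) mxs →
               All (λ zs → stepsNames N' zs ⊆ A ++ B) (mx ∷? mxs)
    ∷?-names (just y⊆A) (just zs⊆B) = just (++⁺ y⊆A zs⊆B)
    ∷?-names (just _)   nothing     = nothing
    ∷?-names nothing    _           = nothing

    ++?-names : ∀ {A B} {mxs mys} →
                All (λ xs → stepsNames N' xs ⊆ A) mxs → All (λ ys → stepsNames N' ys ⊆ B) mys →
                All (λ zs → stepsNames N' zs ⊆ A ++ B) (mxs ++? mys)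
    ++?-names (just {xs} xs⊆A) (just {ys} ys⊆B) =
      just (⊆-trans (⊆-reflexive (stepsNames-++ N' xs ys)) (++⁺ xs⊆A ys⊆B))
    ++?-names (just _) nothing = nothing
    ++?-names nothing  _       = nothing

    oldCell-names : ∀ o d → proj₁ o ≡ d → cellNames N' (fromC (inj₁ o)) ⊆ cellNames N d
    oldCell-names o _ refl = cellNames⊆ N (proj₁ o) N' (fromC (inj₁ o)) λ named →
      let named-N = subst (T ∘ isNamed) (label-old o) named in named-N , name-old o named-N

    newCell-names : ∀ k → cellNames N' (fromC (inj₂ k)) ⊆ cellNames N c
    newCell-names k = cellNames⊆ N c N' (fromC (inj₂ k)) λ named →
      let named-t = subst (T ∘ isNamed) (label-new k) named in inherit k named-t , name-new k named-t

    newSteps-names : ∀ xs → stepsNames N' (map newStp xs) ⊆ cellNames N c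
    newSteps-names xs =
      ⊆-trans (⊆-reflexive (concatMap-map (stepNames N') newStp xs)) (concatMap-⊆ _ xs newStep-names)
      where
      newStep-names : ∀ x → stepNames N' (newStp x) ⊆ cellNames N c
      newStep-names W       = λ ()
      newStep-names (F k _) = newCell-names k
      newStep-names (B k _) = newCell-names k

    segN-names : ∀ i j → All (λ zs → stepsNames N' zs ⊆ cellNames N c) (segN i j)
    segN-names i j = All.map⁺ (universal newSteps-names (seg t i j))

    revSegN-names : ∀ i j → All (λ zs → stepsNames N' zs ⊆ cellNames N c) (Maybe.map revSeg (segN i j))
    revSegN-names i j = All.map⁺ (All.map⁺ (universal revNewSteps-names (seg t i j)))
      where
      revNewSteps-names : ∀ xs → stepsNames N' (revSeg (map newStp xs)) ⊆ cellNames N c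
      revNewSteps-names xs = ⊆-trans (revSeg-names N' (map newStp xs)) (newSteps-names xs)

    weaken : ∀ {A B mxs} → A ⊆ B →
             All (λ zs → stepsNames N' zs ⊆ A) mxs → All (λ zs → stepsNames N' zs ⊆ B) mxs
    weaken A⊆B (just zs⊆A) = just (⊆-trans zs⊆A A⊆B)
    weaken A⊆B nothing     = nothing

    tr1-names : ∀ x → All (λ y → stepNames N' y ⊆ stepNames N x) (tr1 x)
    tr1-names W = just (λ ())
    tr1-names (F d i) with cellKind d in kind-d
    ... | outC o = just (oldCell-names o d (cellKind-outC d o kind-d))
    ... | isC    = nothing
    ... | isC'   = nothing
    tr1-names (B d i) with cellKind d in kind-d
    ... | outC o = just (oldCell-names o d (cellKind-outC d o kind-d))
    ... | isC    = nothing
    ... | isC'   = nothing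

    crossing-names : ∀ d d' i j ys {rest noCross} k k' → cellKind d ≡ k → cellKind d' ≡ k' →
      All (λ zs → stepsNames N' zs ⊆ stepsNames N ys) rest →
      All (λ zs → stepsNames N' zs ⊆ stepsNames N (F d i ∷ W ∷ B d' j ∷ ys)) noCross →
      All (λ zs → stepsNames N' zs ⊆ stepsNames N (F d i ∷ W ∷ B d' j ∷ ys)) (crossing k k' i j rest noCross)
    crossing-names d d' i j ys isC isC' kind-d _ rest-names _ with refl ← cellKind-isC d kind-d =
      weaken (++⁺ʳ (cellNames N c) (xs⊆ys++xs (stepsNames N ys) (cellNames N d')))
             (++?-names (segN-names i j) rest-names)
    crossing-names d d' i j ys isC' isC _ kind-d' rest-names _ with refl ← cellKind-isC d' kind-d' =
      weaken (xs⊆ys++xs (cellNames N c ++ stepsNames N ys) (cellNames N d))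
             (++?-names (revSegN-names j i) rest-names)
    crossing-names d d' i j ys isC      isC      _ _ _ noCross-names = noCross-names
    crossing-names d d' i j ys isC      (outC _) _ _ _ noCross-names = noCross-names
    crossing-names d d' i j ys isC'     isC'     _ _ _ noCross-names = noCross-names
    crossing-names d d' i j ys isC'     (outC _) _ _ _ noCross-names = noCross-names
    crossing-names d d' i j ys (outC _) _        _ _ _ noCross-names = noCross-names

    tr-names : ∀ xs → All (λ ys → stepsNames N' ys ⊆ stepsNames N xs) (tr xs)
    tr-names [] = just (λ ())
    tr-names (W ∷ xs) = ∷?-names (just (λ ())) (tr-names xs)
    tr-names (F d i ∷ W ∷ B d' j ∷ ys) =
      crossing-names d d' i j ys (cellKind d) (cellKind d') refl refl
        (tr-names ys) (∷?-names (tr1-names (F d i)) (tr-names (W ∷ B d' j ∷ ys)))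
    tr-names (B d i ∷ xs)              = ∷?-names (tr1-names (B d i)) (tr-names xs)
    tr-names (F d i ∷ [])              = ∷?-names (tr1-names (F d i)) (tr-names [])
    tr-names (F d i ∷ F d' j ∷ xs)     = ∷?-names (tr1-names (F d i)) (tr-names (F d' j ∷ xs))
    tr-names (F d i ∷ B d' j ∷ xs)     = ∷?-names (tr1-names (F d i)) (tr-names (B d' j ∷ xs))
    tr-names (F d i ∷ W ∷ [])          = ∷?-names (tr1-names (F d i)) (tr-names (W ∷ []))
    tr-names (F d i ∷ W ∷ W ∷ xs)      = ∷?-names (tr1-names (F d i)) (tr-names (W ∷ W ∷ xs))
    tr-names (F d i ∷ W ∷ F d' j ∷ xs) = ∷?-names (tr1-names (F d i)) (tr-names (W ∷ F d' j ∷ xs))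

    collapse-⊆ : ∀ xs → collapse xs ⊆ xs
    collapse-⊆ []               = λ ()
    collapse-⊆ (W ∷ W ∷ xs)     = there ∘ collapse-⊆ (W ∷ xs)
    collapse-⊆ (W ∷ [])         = ∷⁺ʳ W (collapse-⊆ [])
    collapse-⊆ (W ∷ F d i ∷ xs) = ∷⁺ʳ W (collapse-⊆ (F d i ∷ xs))
    collapse-⊆ (W ∷ B d i ∷ xs) = ∷⁺ʳ W (collapse-⊆ (B d i ∷ xs))
    collapse-⊆ (F d i ∷ xs)     = ∷⁺ʳ (F d i) (collapse-⊆ xs)
    collapse-⊆ (B d i ∷ xs)     = ∷⁺ʳ (B d i) (collapse-⊆ xs)

    translate-names : ∀ φ {ψ} → translate φ ≡ just ψ → pathNames N' ψ ⊆ pathNames N φ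
    translate-names φ with corr (RawPath.start φ) | endPort N φ
    ... | nothing | _       = λ ()
    ... | just _  | nothing = λ ()
    ... | just _  | just e with corr e
    ...   | nothing = λ ()
    ...   | just _ with tr (RawPath.steps φ) | tr-names (RawPath.steps φ)
    ...     | nothing | _        = λ ()
    ...     | just xs | just xs⊆ = λ { refl → ⊆-trans (concatMap⁺ (stepNames N') (collapse-⊆ xs)) xs⊆ }

open TranslationNames using (translate-names)

δ-names : ∀ {R R'} {s : DStep R R'} {φ ψ} → δ s φ ψ → dpathNames ψ ⊆ dpathNames φ
δ-names (δ-leaf {s = s} {φ} φ↦ψ) = translate-names _ c c' _ (tmpl-inherit rule) real φ φ↦ψ
  where open Step s
δ-names (δ-sum₁ {s = s} {φ} φ↦ψ) = translate-names _ c c' _ (tmplS-inherit rule zero) real₁ φ φ↦ψ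
  where open StepSum s
δ-names (δ-sum₂ {s = s} {φ} φ↦ψ) = translate-names _ c c' _ (tmplS-inherit rule (suc zero)) real₂ φ φ↦ψ
  where open StepSum s
δ-names (δ-inL φ↦ψ) = δ-names φ↦ψ
δ-names δ-inL'      = λ α∈ → α∈
δ-names (δ-inR φ↦ψ) = δ-names φ↦ψ
δ-names δ-inR'      = λ α∈ → α∈

mainTheorem2 : ∀ {a ℓ : Level} (M : Monoid a ℓ) (e : Name → Monoid.Carrier M) →
    (∀ α → Monoid._≈_ M (Monoid._∙_ M (e α) (e α)) (e α)) →
    (∀ α β → Monoid._≈_ M (Monoid._∙_ M (e α) (e β)) (Monoid._∙_ M (e β) (e α))) →
    ∀ {R R' : Din} (s : DStep R R') (φ : DPath R) (φ' : DPath R') →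
    IsDPath φ → LongEnough s φ →
    δ s φ φ' → (∀ ψ → δ s φ ψ → ψ ≡ φ') →
    Monoid._≈_ M (Factors.n-din M e R φ')
                 (Monoid._∙_ M (Factors.n-din M e R φ) (Factors.n-path M e φ φ'))
mainTheorem2 M e e-idem e-comm {R} s φ φ' _ _ φ↦φ' _ =
  ∏diff-split (dinNames R) (dpathNames φ) (dpathNames φ') (dpathNames⊆dinNames φ) (δ-names φ↦φ')
  where open CommutingIdempotents M e e-idem e-comm
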